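{- Let $\ell\ge 1$ be an integer. For $n\ge 0$, let $\rho_\ell(n)$ denote the number of partitions of $n$ in which the largest part $\lambda$ appears exactly once and the remaining parts form an $\ell$-regular partition of $\lambda$ (a partition of $\lambda$ none of whose parts is divisible by $\ell$). Then, as formal power series (equivalently for $|q|<1$), $$\sum_{n=0}^{\infty}\rho_\ell(n)q^n=\frac{(q^{2\ell};q^{2\ell})_\infty}{(q^2;q^2)_\infty}-\frac{1}{1-q^2}+\frac{q^{2\ell}}{1-q^{2\ell}}.$$
   Context: For $|q|<1$, $(a;q)_\infty=\prod_{k=0}^{\infty}(1-aq^k)$. Since the largest part $\lambda$ appears exactly once, all remaining parts are strictly smaller than $\lambda$, and $n=2\lambda$. The empty partition has no largest part, so $\rho_\ell(0)=0$. -}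

module Defs where

open import Data.Nat as ℕ using (ℕ; zero; suc; _≤_; _<_; _≥_; _≤?_; _<?_; _≥?_)
open import Data.Nat.Divisibility using (_∣_; _∣?_)
open import Data.Integer as ℤ using (ℤ; +_)
open import Data.List using (List; []; _∷_; map; concatMap; filter; length; upTo; zipWith; foldr)
open import Data.Nat.ListAction using (sum)
open import Data.List.Relation.Unary.All using (All; all?)
open import Data.List.Relation.Unary.Linked using (Linked; linked?)
open import Data.Product using (_×_)
open import Data.Empty using (⊥)
open import Relation.Nullary using (Dec; yes; no; ¬_; ¬?)
open import Relation.Nullary.Decidable using (_×-dec_)
open import Relation.Binary.PropositionalEquality using (_≡_)

IsPartition : ℕ → List ℕ → Set
IsPartition n xs = Linked _≥_ xs × All (1 ≤_) xs × sum xs ≡ n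

IsRegular : ℕ → List ℕ → Set
IsRegular ℓ xs = All (λ p → ¬ (ℓ ∣ p)) xs

-- The empty partition has no largest part, hence is excluded.
RhoShape : ℕ → List ℕ → Set
RhoShape ℓ []        = ⊥
RhoShape ℓ (λ₀ ∷ rest) = All (_< λ₀) rest × IsPartition λ₀ rest × IsRegular ℓ rest

isPartition? : ∀ n xs → Dec (IsPartition n xs)
isPartition? n xs = linked? _≥?_ xs ×-dec (all? (1 ≤?_) xs ×-dec (sum xs ℕ.≟ n))

rhoShape? : ∀ ℓ xs → Dec (RhoShape ℓ xs)
rhoShape? ℓ []          = no (λ ())
rhoShape? ℓ (λ₀ ∷ rest) =
  all? (_<? λ₀) rest ×-dec (isPartition? λ₀ rest ×-dec all? (λ p → ¬? (ℓ ∣? p)) rest)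

listsOfLength : ℕ → List ℕ → List (List ℕ)
listsOfLength zero    xs = [] ∷ []
listsOfLength (suc k) xs = concatMap (λ x → map (x ∷_) (listsOfLength k xs)) xs

-- all lists of length ≤ n with entries in {1,…,n}, each exactly once;
-- every partition of n is among them
candidates : ℕ → List (List ℕ)
candidates n = concatMap (λ k → listsOfLength k (map suc (upTo n))) (upTo (suc n))

ρ : ℕ → ℕ → ℕ
ρ ℓ n = length (filter (λ xs → isPartition? n xs ×-dec rhoShape? ℓ xs) (candidates n))

PS : Set
PS = ℕ → ℤ

sumℤ : List ℤ → ℤ
sumℤ = foldr ℤ._+_ (+ 0)

_⊕_ : PS → PS → PS
(f ⊕ g) n = f n ℤ.+ g n

_⊖_ : PS → PS → PS
(f ⊖ g) n = f n ℤ.- g n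

_⊛_ : PS → PS → PS
(f ⊛ g) n = sumℤ (map (λ i → f i ℤ.* g (n ℕ.∸ i)) (upTo (suc n)))

X^ : ℕ → PS
X^ a n with n ℕ.≟ a
... | yes _ = + 1
... | no  _ = + 0

one : PS
one = X^ 0

prodPS : List PS → PS
prodPS = foldr _⊛_ one

-- (q^a ; q^a)_∞ = ∏_{k ≥ 0} (1 - q^{a(k+1)}).  For a ≥ 1 the coefficient
-- of q^n only depends on the factors with k < n + 1, so it is computed
-- from that finite partial product.
poch : ℕ → PS
poch a n = prodPS (map (λ k → one ⊖ X^ (a ℕ.* suc k)) (upTo (suc n))) n

-- multiplicative inverse of a series with constant term 1:
-- g₀ = 1, g_m = - Σ_{i=1}^{m} f_i g_{m-i}.
-- invList f m = [g_m, g_{m-1}, …, g_0]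
invList : PS → ℕ → List ℤ
invList f zero    = + 1 ∷ []
invList f (suc m) =
  ℤ.- sumℤ (zipWith ℤ._*_ (map (λ i → f (suc i)) (upTo (suc m))) (invList f m))
  ∷ invList f m

inv : PS → PS
inv f m with invList f m
... | []    = + 0
... | g ∷ _ = g

-- division by a series with constant term 1
_⊘_ : PS → PS → PS
f ⊘ g = f ⊛ inv g

infixl 7 _⊛_ _⊘_
infixl 6 _⊕_ _⊖_

{-# OPTIONS --safe #-}
-- Both sides are series in q²: the right-hand side is F(q²) for
--   F(q) = (q^ℓ;q^ℓ)_∞/(q;q)_∞ − 1/(1 − q) + q^ℓ/(1 − q^ℓ),
-- while ρ_ℓ vanishes at 0 and at odd arguments, and ρ_ℓ(2λ) counts the ℓ-regular partitions of λ
-- with all parts smaller than λ, i.e. b_ℓ(λ) − [ℓ ∤ λ] for λ ≥ 1, where b_ℓ(λ) counts all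
-- ℓ-regular partitions of λ. On the other side (q^ℓ;q^ℓ)_∞/(q;q)_∞ = ∏_{ℓ ∤ m} (1 − q^m)⁻¹ is the
-- generating function of b_ℓ, and the two geometric series contribute −1 + [ℓ ∣ λ] − [λ = 0] to
-- the coefficient of q^λ. The infinite products are compared through finite truncations, which
-- agree with them up to any given degree, and b_ℓ is matched with the finite products through the
-- recurrence obtained by removing a largest part.
module Submission where

open import Defs
open import Data.Nat using (ℕ; _≤_; _*_)
open import Data.Integer using (+_)
open import Relation.Binary.PropositionalEquality using (_≡_)

open import Algebra.Bundles using (CommutativeMonoid)
open import Algebra.Structures using (IsCommutativeMonoid)
open import Data.Bool using (true; false)
open import Data.Empty using (⊥)
open import Data.Integer as ℤ using (ℤ; -_)
import Data.Integer.Properties as ℤ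
open import Data.Integer.Tactic.RingSolver using (solve-∀)
open import Data.List
  using (List; []; _∷_; [_]; _++_; _∷ʳ_; map; upTo; applyUpTo; zipWith; length; filter; concat; concatMap)
open import Data.List.Properties
  using (map-applyUpTo; map-cong; upTo-∷ʳ; concatMap-++; filter-++; length-++; filter-none; filter-≐;
         filter-accept; filter-reject)
open import Data.List.Relation.Unary.All as All using (All; []; _∷_; all?)
open import Data.List.Relation.Unary.All.Properties using (concat⁺; map⁺; ++⁺)
open import Data.List.Relation.Unary.Linked as Linked using (Linked; [-]; _∷_)
open import Data.List.Relation.Unary.Linked.Properties using (Linked⇒All)
open import Data.Nat using (zero; suc; _+_; _∸_; _<_; _≥_; z≤n; s≤s; z<s; s≤s⁻¹; _≟_; _≤?_; ⌊_/2⌋)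
open import Data.Nat.Divisibility
  using (_∣_; _∣?_; divides; 1∣_; _∣0; n∣n; n∣m*n; ∣⇒≤; ∣m∸n∣n⇒∣m; ∣m+n∣m⇒∣n)
open import Data.Nat.Induction using (<-rec)
open import Data.Nat.ListAction using (sum)
open import Data.Nat.Properties
  using (≤-refl; ≤-trans; n≤1+n; m≤n⇒m≤1+n; m≤m+n; m≤n+m; m≤m*n; m≤n*m; <⇒≱; ≰⇒>; ≤∧≢⇒<;
         m≤n⇒m<n∨m≡n; 1+n≰n; suc-injective; +-suc; +-comm; +-identityʳ; *-identityˡ; +-mono-≤;
         m+[n∸m]≡n; m+n∸m≡n; m∸n≤m; ∸-monoʳ-<; n∸n≡0; even≢odd; n≡⌊n+n/2⌋)
import Data.Nat.Tactic.RingSolver as ℕ-Solver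
open import Data.Product using (_×_; _,_)
open import Data.Sum using (_⊎_; inj₁; inj₂)
open import Function using (id; _∘_)
open import Level using (0ℓ)
open import Relation.Binary.Bundles using (Setoid)
open import Relation.Binary.PropositionalEquality
  using (_≗_; _≢_; refl; sym; trans; cong; cong₂; cong-app; subst; _→-setoid_; module ≡-Reasoning)
import Relation.Binary.Reasoning.Setoid
open import Relation.Nullary using (¬_; ¬?; yes; no; does; contradiction)
open import Relation.Nullary.Decidable using (_×-dec_)
open import Relation.Unary using (Pred; Decidable; ∁; _≐_; _⊆_; _∪_)
open import Relation.Unary.Properties using (_∪?_)

infixr 5 _∙_
_∙_ : ∀ {A : Set} {x y z : A} → x ≡ y → y ≡ z → x ≡ z
_∙_ = trans

-- Formal power series

_≗[_]_ : PS → ℕ → PS → Set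
f ≗[ n ] g = ∀ i → i ≤ n → f i ≡ g i

shift : PS → PS
shift f n = f (suc n)

⊛-at-0 : ∀ f g → (f ⊛ g) 0 ≡ f 0 ℤ.* g 0
⊛-at-0 f g = ℤ.+-identityʳ _

⊛-at-suc : ∀ f g n → (f ⊛ g) (suc n) ≡ f 0 ℤ.* g (suc n) ℤ.+ (shift f ⊛ g) n
⊛-at-suc f g n = cong (λ xs → f 0 ℤ.* g (suc n) ℤ.+ sumℤ xs)
  (map-applyUpTo suc (λ i → f i ℤ.* g (suc n ∸ i)) (suc n)
   ∙ sym (map-applyUpTo id (λ i → f (suc i) ℤ.* g (n ∸ i)) (suc n)))

⊛-cong-at : ∀ {f f' g g'} n → f ≗[ n ] f' → g ≗[ n ] g' → (f ⊛ g) n ≡ (f' ⊛ g') n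
⊛-cong-at {f} {f'} {g} {g'} zero f≗f' g≗g' =
  ⊛-at-0 f g ∙ cong₂ ℤ._*_ (f≗f' 0 z≤n) (g≗g' 0 z≤n) ∙ sym (⊛-at-0 f' g')
⊛-cong-at {f} {f'} {g} {g'} (suc n) f≗f' g≗g' =
  ⊛-at-suc f g n
  ∙ cong₂ ℤ._+_ (cong₂ ℤ._*_ (f≗f' 0 z≤n) (g≗g' (suc n) ≤-refl))
                (⊛-cong-at n (λ i i≤n → f≗f' (suc i) (s≤s i≤n)) (λ i i≤n → g≗g' i (m≤n⇒m≤1+n i≤n)))
  ∙ sym (⊛-at-suc f' g' n)

⊛-cong-upTo : ∀ {f f' g g'} n → f ≗[ n ] f' → g ≗[ n ] g' → (f ⊛ g) ≗[ n ] (f' ⊛ g')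
⊛-cong-upTo n f≗f' g≗g' i i≤n =
  ⊛-cong-at i (λ j j≤i → f≗f' j (≤-trans j≤i i≤n)) (λ j j≤i → g≗g' j (≤-trans j≤i i≤n))

⊛-cong : ∀ {f f' g g'} → f ≗ f' → g ≗ g' → (f ⊛ g) ≗ (f' ⊛ g')
⊛-cong f≗f' g≗g' n = ⊛-cong-at n (λ i _ → f≗f' i) (λ i _ → g≗g' i)

⊛-congˡ : ∀ {f f'} → f ≗ f' → ∀ g → (f ⊛ g) ≗ (f' ⊛ g)
⊛-congˡ f≗f' g = ⊛-cong {g = g} {g} f≗f' (λ _ → refl)

⊛-congʳ : ∀ f {g g'} → g ≗ g' → (f ⊛ g) ≗ (f ⊛ g')
⊛-congʳ f g≗g' = ⊛-cong {f} {f} (λ _ → refl) g≗g'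

⊛-linearˡ : ∀ c f g h n → ((λ i → c ℤ.* f i ℤ.+ g i) ⊛ h) n ≡ c ℤ.* (f ⊛ h) n ℤ.+ (g ⊛ h) n
⊛-linearˡ c f g h zero =
  ⊛-at-0 (λ i → c ℤ.* f i ℤ.+ g i) h
  ∙ distrib c (f 0) (g 0) (h 0)
  ∙ sym (cong₂ (λ x y → c ℤ.* x ℤ.+ y) (⊛-at-0 f h) (⊛-at-0 g h))
  where
  distrib : ∀ c a b x → (c ℤ.* a ℤ.+ b) ℤ.* x ≡ c ℤ.* (a ℤ.* x) ℤ.+ b ℤ.* x
  distrib = solve-∀
⊛-linearˡ c f g h (suc n) =
  ⊛-at-suc (λ i → c ℤ.* f i ℤ.+ g i) h n
  ∙ cong (λ z → (c ℤ.* f 0 ℤ.+ g 0) ℤ.* h (suc n) ℤ.+ z) (⊛-linearˡ c (shift f) (shift g) h n)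
  ∙ regroup c (f 0) (g 0) (h (suc n)) ((shift f ⊛ h) n) ((shift g ⊛ h) n)
  ∙ sym (cong₂ (λ x y → c ℤ.* x ℤ.+ y) (⊛-at-suc f h n) (⊛-at-suc g h n))
  where
  regroup : ∀ c a b x u v →
    (c ℤ.* a ℤ.+ b) ℤ.* x ℤ.+ (c ℤ.* u ℤ.+ v) ≡ c ℤ.* (a ℤ.* x ℤ.+ u) ℤ.+ (b ℤ.* x ℤ.+ v)
  regroup = solve-∀

⊛-distribʳ-⊖ : ∀ f g h n → ((f ⊖ g) ⊛ h) n ≡ (f ⊛ h) n ℤ.- (g ⊛ h) n
⊛-distribʳ-⊖ f g h n =
  ⊛-congˡ (λ i → as-linear (f i) (g i)) h n
  ∙ ⊛-linearˡ (- + 1) g f h n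
  ∙ from-linear ((g ⊛ h) n) ((f ⊛ h) n)
  where
  as-linear : ∀ a b → a ℤ.- b ≡ - + 1 ℤ.* b ℤ.+ a
  as-linear = solve-∀
  from-linear : ∀ b a → - + 1 ℤ.* b ℤ.+ a ≡ a ℤ.- b
  from-linear = solve-∀

⊛-zeroˡ : ∀ {f} g → (∀ i → f i ≡ + 0) → ∀ n → (f ⊛ g) n ≡ + 0
⊛-zeroˡ {f} g f≡0 zero = ⊛-at-0 f g ∙ cong (ℤ._* g 0) (f≡0 0)
⊛-zeroˡ {f} g f≡0 (suc n) =
  ⊛-at-suc f g n ∙ cong₂ ℤ._+_ (cong (ℤ._* g (suc n)) (f≡0 0)) (⊛-zeroˡ g (f≡0 ∘ suc) n)

X^-diag : ∀ a → X^ a a ≡ + 1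
X^-diag a with a ≟ a
... | yes _  = refl
... | no a≢a = contradiction refl a≢a

X^-off : ∀ {a n} → n ≢ a → X^ a n ≡ + 0
X^-off {a} {n} n≢a with n ≟ a
... | yes n≡a = contradiction n≡a n≢a
... | no _    = refl

shift-X^ : ∀ a → shift (X^ (suc a)) ≗ X^ a
shift-X^ a n with n ≟ a
... | yes refl = X^-diag (suc a)
... | no n≢a   = X^-off (n≢a ∘ suc-injective)

X^-⊛-< : ∀ a f n → n < a → (X^ a ⊛ f) n ≡ + 0
X^-⊛-< (suc a) f zero _ = ⊛-at-0 (X^ (suc a)) f
X^-⊛-< (suc a) f (suc n) (s≤s n<a) =
  ⊛-at-suc (X^ (suc a)) f n
  ∙ ℤ.+-identityˡ _
  ∙ ⊛-congˡ (shift-X^ a) f n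
  ∙ X^-⊛-< a f n n<a

X^-⊛-≥ : ∀ a f n → a ≤ n → (X^ a ⊛ f) n ≡ f (n ∸ a)
X^-⊛-≥ zero f zero _ = ⊛-at-0 one f ∙ ℤ.*-identityˡ (f 0)
X^-⊛-≥ zero f (suc n) _ =
  ⊛-at-suc one f n
  ∙ cong₂ ℤ._+_ (ℤ.*-identityˡ (f (suc n))) (⊛-zeroˡ f (λ i → X^-off {0} {suc i} (λ ())) n)
  ∙ ℤ.+-identityʳ (f (suc n))
X^-⊛-≥ (suc a) f (suc n) (s≤s a≤n) =
  ⊛-at-suc (X^ (suc a)) f n
  ∙ ℤ.+-identityˡ _
  ∙ ⊛-congˡ (shift-X^ a) f n
  ∙ X^-⊛-≥ a f n a≤n

⊛-identityˡ : ∀ f → (one ⊛ f) ≗ f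
⊛-identityˡ f n = X^-⊛-≥ 0 f n z≤n

⊛-comm : ∀ f g → (f ⊛ g) ≗ (g ⊛ f)
⊛-comm f g zero = ⊛-at-0 f g ∙ ℤ.*-comm (f 0) (g 0) ∙ sym (⊛-at-0 g f)
⊛-comm f g (suc zero) =
  ⊛-at-suc f g 0 ∙ cong (λ z → f 0 ℤ.* g 1 ℤ.+ z) (⊛-at-0 (shift f) g)
  ∙ swap (f 0) (g 1) (f 1) (g 0)
  ∙ sym (⊛-at-suc g f 0 ∙ cong (λ z → g 0 ℤ.* f 1 ℤ.+ z) (⊛-at-0 (shift g) f))
  where
  swap : ∀ a b c d → a ℤ.* b ℤ.+ c ℤ.* d ≡ d ℤ.* c ℤ.+ b ℤ.* a
  swap = solve-∀
⊛-comm f g (suc (suc m)) =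
  ⊛-at-suc f g (suc m)
  ∙ cong (λ z → f 0 ℤ.* g (2 + m) ℤ.+ z)
      (⊛-comm (shift f) g (suc m) ∙ ⊛-at-suc g (shift f) m
       ∙ cong (λ z → g 0 ℤ.* f (2 + m) ℤ.+ z) (⊛-comm (shift g) (shift f) m))
  ∙ swap (f 0 ℤ.* g (2 + m)) (g 0 ℤ.* f (2 + m)) ((shift f ⊛ shift g) m)
  ∙ sym (⊛-at-suc g f (suc m)
         ∙ cong (λ z → g 0 ℤ.* f (2 + m) ℤ.+ z) (⊛-comm (shift g) f (suc m) ∙ ⊛-at-suc f (shift g) m))
  where
  swap : ∀ a b c → a ℤ.+ (b ℤ.+ c) ≡ b ℤ.+ (a ℤ.+ c)
  swap = solve-∀

⊛-identityʳ : ∀ f → (f ⊛ one) ≗ f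
⊛-identityʳ f n = ⊛-comm f one n ∙ ⊛-identityˡ f n

⊛-assoc : ∀ f g h → ((f ⊛ g) ⊛ h) ≗ (f ⊛ (g ⊛ h))
⊛-assoc f g h zero =
  ⊛-at-0 (f ⊛ g) h ∙ cong (ℤ._* h 0) (⊛-at-0 f g) ∙ ℤ.*-assoc (f 0) (g 0) (h 0)
  ∙ sym (⊛-at-0 f (g ⊛ h) ∙ cong (f 0 ℤ.*_) (⊛-at-0 g h))
⊛-assoc f g h (suc n) =
  ⊛-at-suc (f ⊛ g) h n
  ∙ cong₂ ℤ._+_
      (cong (ℤ._* h (suc n)) (⊛-at-0 f g))
      (⊛-congˡ (⊛-at-suc f g) h n
       ∙ ⊛-linearˡ (f 0) (shift g) (shift f ⊛ g) h n
       ∙ cong (λ z → f 0 ℤ.* (shift g ⊛ h) n ℤ.+ z) (⊛-assoc (shift f) g h n))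
  ∙ regroup (f 0) (g 0) (h (suc n)) ((shift g ⊛ h) n) ((shift f ⊛ (g ⊛ h)) n)
  ∙ sym (⊛-at-suc f (g ⊛ h) n ∙ cong (λ z → f 0 ℤ.* z ℤ.+ (shift f ⊛ (g ⊛ h)) n) (⊛-at-suc g h n))
  where
  regroup : ∀ a b c u v → a ℤ.* b ℤ.* c ℤ.+ (a ℤ.* u ℤ.+ v) ≡ a ℤ.* (b ℤ.* c ℤ.+ u) ℤ.+ v
  regroup = solve-∀

⊛-isCommutativeMonoid : IsCommutativeMonoid _≗_ _⊛_ one
⊛-isCommutativeMonoid = record
  { isMonoid = record
    { isSemigroup = record
      { isMagma = record { isEquivalence = Setoid.isEquivalence (ℕ →-setoid ℤ) ; ∙-cong = ⊛-cong }
      ; assoc   = ⊛-assoc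
      }
    ; identity = ⊛-identityˡ , ⊛-identityʳ
    }
  ; comm = ⊛-comm
  }

⊛-commutativeMonoid : CommutativeMonoid _ _
⊛-commutativeMonoid = record { isCommutativeMonoid = ⊛-isCommutativeMonoid }

open import Algebra.Properties.CommutativeSemigroup
  (CommutativeMonoid.commutativeSemigroup ⊛-commutativeMonoid) using (interchange)
module ≗-Reasoning = Relation.Binary.Reasoning.Setoid (ℕ →-setoid ℤ)

private
  zipWith-map-diagonal : ∀ (a b : ℕ → ℤ) xs →
    zipWith ℤ._*_ (map a xs) (map b xs) ≡ map (λ i → a i ℤ.* b i) xs
  zipWith-map-diagonal a b []       = refl
  zipWith-map-diagonal a b (x ∷ xs) = cong (a x ℤ.* b x ∷_) (zipWith-map-diagonal a b xs)

invList-as-map : ∀ f m → invList f m ≡ map (λ i → inv f (m ∸ i)) (upTo (suc m))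
invList-as-map f zero    = refl
invList-as-map f (suc m) = cong (inv f (suc m) ∷_)
  (invList-as-map f m
   ∙ map-applyUpTo id (λ i → inv f (m ∸ i)) (suc m)
   ∙ sym (map-applyUpTo suc (λ i → inv f (suc m ∸ i)) (suc m)))

inv-at-suc : ∀ f m → inv f (suc m) ≡ - (shift f ⊛ inv f) m
inv-at-suc f m = cong (λ xs → - sumℤ (zipWith ℤ._*_ (map (λ i → f (suc i)) (upTo (suc m))) xs))
                      (invList-as-map f m)
  ∙ cong (λ xs → - sumℤ xs) (zipWith-map-diagonal (λ i → f (suc i)) (λ i → inv f (m ∸ i)) (upTo (suc m)))

⊛-inverseʳ : ∀ f → f 0 ≡ + 1 → (f ⊛ inv f) ≗ one
⊛-inverseʳ f f₀≡1 zero = ⊛-at-0 f (inv f) ∙ cong (ℤ._* + 1) f₀≡1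
⊛-inverseʳ f f₀≡1 (suc m) =
  ⊛-at-suc f (inv f) m
  ∙ cong₂ (λ a b → a ℤ.* b ℤ.+ (shift f ⊛ inv f) m) f₀≡1 (inv-at-suc f m)
  ∙ cancel ((shift f ⊛ inv f) m)
  ∙ sym (X^-off {0} {suc m} (λ ()))
  where
  cancel : ∀ x → + 1 ℤ.* (- x) ℤ.+ x ≡ + 0
  cancel = solve-∀

⊛-inverseˡ : ∀ f → f 0 ≡ + 1 → (inv f ⊛ f) ≗ one
⊛-inverseˡ f f₀≡1 n = ⊛-comm (inv f) f n ∙ ⊛-inverseʳ f f₀≡1 n

⊘-unique : ∀ {f} g h n → g 0 ≡ + 1 → (h ⊛ g) ≗[ n ] f → h n ≡ (f ⊘ g) n
⊘-unique {f} g h n g₀≡1 hg≗f = begin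
  h n                   ≡⟨ ⊛-identityʳ h n ⟨
  (h ⊛ one) n           ≡⟨ ⊛-congʳ h (⊛-inverseʳ g g₀≡1) n ⟨
  (h ⊛ (g ⊛ inv g)) n   ≡⟨ ⊛-assoc h g (inv g) n ⟨
  ((h ⊛ g) ⊛ inv g) n   ≡⟨ ⊛-cong-at {g = inv g} {inv g} n hg≗f (λ _ _ → refl) ⟩
  (f ⊛ inv g) n         ∎
  where open ≡-Reasoning

⊘-cancel : ∀ f g → g 0 ≡ + 1 → ((f ⊘ g) ⊛ g) ≗ f
⊘-cancel f g g₀≡1 n =
  ⊛-assoc f (inv g) g n ∙ ⊛-congʳ f (⊛-inverseˡ g g₀≡1) n ∙ ⊛-identityʳ f n

-- Geometric series

geometric : ℕ → PS
geometric a n with a ∣? n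
... | yes _ = + 1
... | no  _ = + 0

geometric-∣ : ∀ {a n} → a ∣ n → geometric a n ≡ + 1
geometric-∣ {a} {n} a∣n with a ∣? n
... | yes _  = refl
... | no a∤n = contradiction a∣n a∤n

geometric-∤ : ∀ {a n} → ¬ a ∣ n → geometric a n ≡ + 0
geometric-∤ {a} {n} a∤n with a ∣? n
... | yes a∣n = contradiction a∣n a∤n
... | no _    = refl

geometric-∸ : ∀ {a n} → a ≤ n → geometric a (n ∸ a) ≡ geometric a n
geometric-∸ {a} {n} a≤n with a ∣? n
... | yes a∣n = geometric-∣ (∣m+n∣m⇒∣n (subst (a ∣_) (sym (m+[n∸m]≡n a≤n)) a∣n) n∣n)
... | no a∤n  = geometric-∤ (λ a∣n∸a → a∤n (∣m∸n∣n⇒∣m a a≤n a∣n∸a n∣n))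

geometric-below : ∀ {a n} → n < a → geometric a n ≡ one n
geometric-below {a} {zero}  _   = geometric-∣ (a ∣0) ∙ sym (X^-diag 0)
geometric-below {a} {suc n} n<a =
  geometric-∤ (λ a∣n → <⇒≱ n<a (∣⇒≤ a∣n)) ∙ sym (X^-off {0} {suc n} (λ ()))

X^-⊛-geometric : ∀ a → 1 ≤ a → ∀ n → (X^ a ⊛ geometric a) n ≡ geometric a n ℤ.- one n
X^-⊛-geometric a 1≤a n with a ≤? n
... | yes a≤n =
  X^-⊛-≥ a (geometric a) n a≤n ∙ geometric-∸ a≤n
  ∙ sym (cong (λ z → geometric a n ℤ.- z) one-off ∙ ℤ.+-identityʳ _)
  where
  one-off : one n ≡ + 0
  one-off = X^-off (λ { refl → <⇒≱ 1≤a a≤n })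
... | no a≰n = X^-⊛-< a (geometric a) n (≰⇒> a≰n)
  ∙ sym (cong (ℤ._- one n) (geometric-below (≰⇒> a≰n)) ∙ ℤ.+-inverseʳ (one n))

inv-geometric : ∀ a → 1 ≤ a → inv (one ⊖ X^ a) ≗ geometric a
inv-geometric (suc a) 1≤a n =
  sym (⊘-unique (one ⊖ X^ (suc a)) G n refl series-identity ∙ ⊛-identityˡ (inv (one ⊖ X^ (suc a))) n)
  where
  G = geometric (suc a)
  series-identity : (G ⊛ (one ⊖ X^ (suc a))) ≗[ n ] one
  series-identity i _ =
    ⊛-comm G (one ⊖ X^ (suc a)) i
    ∙ ⊛-distribʳ-⊖ one (X^ (suc a)) G i
    ∙ cong₂ ℤ._-_ (⊛-identityˡ G i) (X^-⊛-geometric (suc a) 1≤a i)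
    ∙ cancel (G i) (one i)
    where
    cancel : ∀ x y → x ℤ.- (x ℤ.- y) ≡ y
    cancel = solve-∀

one⊘geometric : ∀ a → 1 ≤ a → ∀ n → (one ⊘ (one ⊖ X^ a)) n ≡ geometric a n
one⊘geometric a 1≤a n = ⊛-identityˡ (inv (one ⊖ X^ a)) n ∙ inv-geometric a 1≤a n

X^⊘geometric : ∀ a → 1 ≤ a → ∀ n → (X^ a ⊘ (one ⊖ X^ a)) n ≡ geometric a n ℤ.- one n
X^⊘geometric a 1≤a n = ⊛-congʳ (X^ a) (inv-geometric a 1≤a) n ∙ X^-⊛-geometric a 1≤a n

-- Finite products

Π : (ℕ → PS) → ℕ → PS
Π φ n = prodPS (applyUpTo φ n)

Π-snoc : ∀ φ n → Π φ (suc n) ≗ (Π φ n ⊛ φ n)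
Π-snoc φ zero    = λ i → ⊛-identityʳ (φ 0) i ∙ sym (⊛-identityˡ (φ 0) i)
Π-snoc φ (suc n) = begin
  φ 0 ⊛ Π (φ ∘ suc) (suc n)         ≈⟨ ⊛-congʳ (φ 0) (Π-snoc (φ ∘ suc) n) ⟩
  φ 0 ⊛ (Π (φ ∘ suc) n ⊛ φ (suc n)) ≈⟨ ⊛-assoc (φ 0) (Π (φ ∘ suc) n) (φ (suc n)) ⟨
  Π φ (suc n) ⊛ φ (suc n)           ∎
  where open ≗-Reasoning

Π-⊛ : ∀ φ ψ n → Π (λ k → φ k ⊛ ψ k) n ≗ (Π φ n ⊛ Π ψ n)
Π-⊛ φ ψ zero    = λ i → sym (⊛-identityˡ one i)
Π-⊛ φ ψ (suc n) = begin
  (φ 0 ⊛ ψ 0) ⊛ Π (λ k → φ (suc k) ⊛ ψ (suc k)) n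
    ≈⟨ ⊛-congʳ (φ 0 ⊛ ψ 0) (Π-⊛ (φ ∘ suc) (ψ ∘ suc) n) ⟩
  (φ 0 ⊛ ψ 0) ⊛ (Π (φ ∘ suc) n ⊛ Π (ψ ∘ suc) n)
    ≈⟨ interchange (φ 0) (ψ 0) (Π (φ ∘ suc) n) (Π (ψ ∘ suc) n) ⟩
  Π φ (suc n) ⊛ Π ψ (suc n) ∎
  where open ≗-Reasoning

Π-+ : ∀ φ m n → Π φ (m + n) ≗ (Π φ m ⊛ Π (λ i → φ (m + i)) n)
Π-+ φ zero    n = λ i → sym (⊛-identityˡ (Π φ n) i)
Π-+ φ (suc m) n = begin
  φ 0 ⊛ Π (φ ∘ suc) (m + n)                          ≈⟨ ⊛-congʳ (φ 0) (Π-+ (φ ∘ suc) m n) ⟩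
  φ 0 ⊛ (Π (φ ∘ suc) m ⊛ Π (λ i → φ (suc m + i)) n)  ≈⟨ ⊛-assoc (φ 0) (Π (φ ∘ suc) m) _ ⟨
  Π φ (suc m) ⊛ Π (λ i → φ (suc m + i)) n            ∎
  where open ≗-Reasoning

Π-trivial : ∀ φ n t → (∀ k → k < n → φ k ≗[ t ] one) → Π φ n ≗[ t ] one
Π-trivial φ zero    t _       i _   = refl
Π-trivial φ (suc n) t trivial i i≤t =
  ⊛-cong-upTo t (trivial 0 (s≤s z≤n)) tail-trivial i i≤t ∙ ⊛-identityˡ one i
  where
  tail-trivial : Π (φ ∘ suc) n ≗[ t ] one
  tail-trivial = Π-trivial (φ ∘ suc) n t (λ k k<n → trivial (suc k) (s≤s k<n))

Π-cong : ∀ {φ ψ} n → (∀ k → φ k ≗ ψ k) → Π φ n ≗ Π ψ n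
Π-cong zero    φ≗ψ = λ _ → refl
Π-cong (suc n) φ≗ψ = ⊛-cong (φ≗ψ 0) (Π-cong n (φ≗ψ ∘ suc))

Π-stable : ∀ φ m j t → (∀ k → m ≤ k → φ k ≗[ t ] one) → Π φ (m + j) ≗[ t ] Π φ m
Π-stable φ m j t trivial i i≤t =
  Π-+ φ m j i
  ∙ ⊛-cong-upTo {Π φ m} {Π φ m} t (λ _ _ → refl) tail-trivial i i≤t
  ∙ ⊛-identityʳ (Π φ m) i
  where
  tail-trivial : Π (λ k → φ (m + k)) j ≗[ t ] one
  tail-trivial = Π-trivial (λ k → φ (m + k)) j t (λ k _ → trivial (m + k) (m≤m+n m k))

pochFactor : ℕ → ℕ → PS
pochFactor a k = one ⊖ X^ (a * suc k)

poch-as-Π : ∀ a n → poch a n ≡ Π (pochFactor a) (suc n) n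
poch-as-Π a n = cong (λ fs → prodPS fs n) (map-applyUpTo id (pochFactor a) (suc n))

pochFactor-trivial : ∀ a k t → t < a * suc k → pochFactor a k ≗[ t ] one
pochFactor-trivial a k t t<deg i i≤t =
  cong (λ z → one i ℤ.- z) (X^-off (λ { refl → <⇒≱ t<deg i≤t })) ∙ ℤ.+-identityʳ (one i)

poch-≗-Π : ∀ a → 1 ≤ a → ∀ n M → n < M → poch a ≗[ n ] Π (pochFactor a) M
poch-≗-Π (suc a) _ n M n<M i i≤n = begin
  poch (suc a) i                                  ≡⟨ poch-as-Π (suc a) i ⟩
  Π φ (suc i) i                                   ≡⟨ Π-stable φ (suc i) (M ∸ suc i) i trivial i ≤-refl ⟨
  Π φ (suc i + (M ∸ suc i)) i                     ≡⟨ cong (λ m → Π φ m i) (m+[n∸m]≡n i<M) ⟩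
  Π φ M i                                         ∎
  where
  open ≡-Reasoning
  φ = pochFactor (suc a)
  i<M : suc i ≤ M
  i<M = ≤-trans (s≤s i≤n) n<M
  trivial : ∀ k → suc i ≤ k → φ k ≗[ i ] one
  trivial k i<k = pochFactor-trivial (suc a) k i (≤-trans (m≤n⇒m≤1+n i<k) (m≤n*m (suc k) (suc a)))

-- The substitution q ↦ q²

data Parity : ℕ → Set where
  even : ∀ m → Parity (m + m)
  odd  : ∀ m → Parity (suc (m + m))

parity : ∀ n → Parity n
parity zero = even 0
parity (suc n) with parity n
... | even m = odd m
... | odd m  = subst Parity (cong suc (+-suc m m)) (even (suc m))

m+m≡n+n⇒m≡n : ∀ {m n} → m + m ≡ n + n → m ≡ n
m+m≡n+n⇒m≡n {m} {n} e = n≡⌊n+n/2⌋ m ∙ cong ⌊_/2⌋ e ∙ sym (n≡⌊n+n/2⌋ n)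

m+m≢1+n+n : ∀ m n → m + m ≢ suc (n + n)
m+m≢1+n+n m n e =
  even≢odd m n (cong (λ k → m + k) (+-identityʳ m) ∙ e ∙ cong (λ k → suc (n + k)) (sym (+-identityʳ n)))

dilate : PS → PS
dilate f zero          = f zero
dilate f (suc zero)    = + 0
dilate f (suc (suc n)) = dilate (shift f) n

dilate-even : ∀ f m → dilate f (m + m) ≡ f m
dilate-even f zero    = refl
dilate-even f (suc m) = cong (dilate f ∘ suc) (+-suc m m) ∙ dilate-even (shift f) m

dilate-odd : ∀ f m → dilate f (suc (m + m)) ≡ + 0
dilate-odd f zero    = refl
dilate-odd f (suc m) = cong (dilate (shift f)) (+-suc m m) ∙ dilate-odd (shift f) m

dilate-cong-upTo : ∀ {f g} n → f ≗[ n ] g → dilate f ≗[ n ] dilate g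
dilate-cong-upTo n       f≗g zero          _           = f≗g 0 z≤n
dilate-cong-upTo n       f≗g (suc zero)    _           = refl
dilate-cong-upTo (suc n) f≗g (suc (suc i)) (s≤s i+1≤n) =
  dilate-cong-upTo n (λ j j≤n → f≗g (suc j) (s≤s j≤n)) i (≤-trans (n≤1+n i) i+1≤n)

dilate-cong : ∀ {f g} → f ≗ g → dilate f ≗ dilate g
dilate-cong f≗g n = dilate-cong-upTo n (λ i _ → f≗g i) n ≤-refl

dilate-pointwise : ∀ (_⊙_ : ℤ → ℤ → ℤ) → (+ 0) ⊙ (+ 0) ≡ + 0 →
                   ∀ f g → dilate (λ i → f i ⊙ g i) ≗ (λ i → dilate f i ⊙ dilate g i)
dilate-pointwise _⊙_ 0⊙0≡0 f g zero          = refl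
dilate-pointwise _⊙_ 0⊙0≡0 f g (suc zero)    = sym 0⊙0≡0
dilate-pointwise _⊙_ 0⊙0≡0 f g (suc (suc n)) = dilate-pointwise _⊙_ 0⊙0≡0 (shift f) (shift g) n

dilate-X^ : ∀ a → dilate (X^ a) ≗ X^ (a + a)
dilate-X^ a n with parity n
... | odd m  = dilate-odd (X^ a) m ∙ sym (X^-off (λ e → m+m≢1+n+n a m (sym e)))
... | even m with m ≟ a
...   | yes refl = dilate-even (X^ a) m ∙ X^-diag m ∙ sym (X^-diag (m + m))
...   | no m≢a   = dilate-even (X^ a) m ∙ X^-off m≢a ∙ sym (X^-off (m≢a ∘ m+m≡n+n⇒m≡n))

dilate-⊛ : ∀ f g → dilate (f ⊛ g) ≗ (dilate f ⊛ dilate g)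
dilate-⊛ f g zero = ⊛-at-0 f g ∙ sym (⊛-at-0 (dilate f) (dilate g))
dilate-⊛ f g (suc zero) =
  sym (⊛-at-suc (dilate f) (dilate g) 0 ∙ cong₂ ℤ._+_ (ℤ.*-zeroʳ (f 0)) (⊛-at-0 (shift (dilate f)) (dilate g)))
dilate-⊛ f g (suc (suc n)) = begin
  dilate (shift (f ⊛ g)) n
    ≡⟨ dilate-cong (⊛-at-suc f g) n ⟩
  dilate (λ i → f 0 ℤ.* shift g i ℤ.+ (shift f ⊛ g) i) n
    ≡⟨ dilate-pointwise (λ x y → f 0 ℤ.* x ℤ.+ y) (cong (ℤ._+ + 0) (ℤ.*-zeroʳ (f 0)))
                        (shift g) (shift f ⊛ g) n ⟩
  f 0 ℤ.* dilate (shift g) n ℤ.+ dilate (shift f ⊛ g) n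
    ≡⟨ cong (λ z → f 0 ℤ.* dilate (shift g) n ℤ.+ z) (dilate-⊛ (shift f) g n) ⟩
  f 0 ℤ.* dilate (shift g) n ℤ.+ (dilate (shift f) ⊛ dilate g) n
    ≡⟨ cong (λ z → f 0 ℤ.* dilate (shift g) n ℤ.+ z) (ℤ.+-identityˡ _) ⟨
  f 0 ℤ.* dilate (shift g) n ℤ.+ (+ 0 ℤ.* dilate g (suc n) ℤ.+ (dilate (shift f) ⊛ dilate g) n)
    ≡⟨ cong (λ z → f 0 ℤ.* dilate (shift g) n ℤ.+ z) (⊛-at-suc (shift (dilate f)) (dilate g) n) ⟨
  f 0 ℤ.* dilate (shift g) n ℤ.+ (shift (dilate f) ⊛ dilate g) (suc n)
    ≡⟨ ⊛-at-suc (dilate f) (dilate g) (suc n) ⟨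
  (dilate f ⊛ dilate g) (suc (suc n)) ∎
  where open ≡-Reasoning

dilate-one⊖X^ : ∀ c d → c + c ≡ d → dilate (one ⊖ X^ c) ≗ (one ⊖ X^ d)
dilate-one⊖X^ c d c+c≡d n =
  dilate-pointwise ℤ._-_ refl one (X^ c) n
  ∙ cong₂ ℤ._-_ (dilate-X^ 0 n) (dilate-X^ c n ∙ cong (λ e → X^ e n) c+c≡d)

dilate-Π : ∀ φ n → dilate (Π φ n) ≗ Π (dilate ∘ φ) n
dilate-Π φ zero    = dilate-X^ 0
dilate-Π φ (suc n) i = dilate-⊛ (φ 0) (Π (φ ∘ suc) n) i ∙ ⊛-congʳ (dilate (φ 0)) (dilate-Π (φ ∘ suc) n) i

poch-dilate : ∀ a → 1 ≤ a → poch (2 * a) ≗ dilate (poch a)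
poch-dilate (suc a) 1≤a n = begin
  poch (2 * suc a) n
    ≡⟨ poch-≗-Π (2 * suc a) (s≤s z≤n) n (suc n) ≤-refl n ≤-refl ⟩
  Π (pochFactor (2 * suc a)) (suc n) n
    ≡⟨ Π-cong (suc n) (λ k → dilate-one⊖X^ (suc a * suc k) (2 * suc a * suc k) (double k)) n ⟨
  Π (dilate ∘ pochFactor (suc a)) (suc n) n
    ≡⟨ dilate-Π (pochFactor (suc a)) (suc n) n ⟨
  dilate (Π (pochFactor (suc a)) (suc n)) n
    ≡⟨ dilate-cong-upTo n (poch-≗-Π (suc a) 1≤a n (suc n) ≤-refl) n ≤-refl ⟨
  dilate (poch (suc a)) n ∎
  where
  open ≡-Reasoning
  double-assoc : ∀ a k → a * k + a * k ≡ 2 * a * k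
  double-assoc = ℕ-Solver.solve-∀
  double : ∀ k → suc a * suc k + suc a * suc k ≡ 2 * suc a * suc k
  double k = double-assoc (suc a) (suc k)

⊘-dilate : ∀ {f g f' g'} → g 0 ≡ + 1 → f' ≗ dilate f → g' ≗ dilate g → (f' ⊘ g') ≗ dilate (f ⊘ g)
⊘-dilate {f} {g} {f'} {g'} g₀≡1 f'≗ g'≗ n = sym (⊘-unique g' (dilate (f ⊘ g)) n (g'≗ 0 ∙ g₀≡1) product)
  where
  product : (dilate (f ⊘ g) ⊛ g') ≗[ n ] f'
  product i _ =
    ⊛-congʳ (dilate (f ⊘ g)) g'≗ i
    ∙ sym (dilate-⊛ (f ⊘ g) g i)
    ∙ dilate-cong (⊘-cancel f g g₀≡1) i
    ∙ sym (f'≗ i)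

closedForm : ℕ → ℕ → PS
closedForm a b = poch b ⊘ poch a ⊖ one ⊘ (one ⊖ X^ a) ⊕ X^ b ⊘ (one ⊖ X^ b)

closedForm-dilate : ∀ a b → 1 ≤ a → 1 ≤ b → closedForm (2 * a) (2 * b) ≗ dilate (closedForm a b)
closedForm-dilate (suc a) (suc b) 1≤a 1≤b n = begin
  closedForm (2 * suc a) (2 * suc b) n
    ≡⟨ cong₂ ℤ._+_
         (cong₂ ℤ._-_ (⊘-dilate refl (poch-dilate (suc b) 1≤b) (poch-dilate (suc a) 1≤a) n)
                      (⊘-dilate {f = one} refl (λ i → sym (dilate-X^ 0 i)) (dilate⊖ (suc a)) n))
         (⊘-dilate refl (λ i → sym (dilate-X^ (suc b) i ∙ cong (λ e → X^ e i) (double (suc b))))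
                   (dilate⊖ (suc b)) n) ⟩
  dilate (poch (suc b) ⊘ poch (suc a)) n ℤ.- dilate (one ⊘ (one ⊖ X^ (suc a))) n
    ℤ.+ dilate (X^ (suc b) ⊘ (one ⊖ X^ (suc b))) n
    ≡⟨ cong (ℤ._+ dilate (X^ (suc b) ⊘ (one ⊖ X^ (suc b))) n) (dilate-pointwise ℤ._-_ refl _ _ n) ⟨
  dilate (poch (suc b) ⊘ poch (suc a) ⊖ one ⊘ (one ⊖ X^ (suc a))) n ℤ.+ dilate (X^ (suc b) ⊘ (one ⊖ X^ (suc b))) n
    ≡⟨ dilate-pointwise ℤ._+_ refl _ _ n ⟨
  dilate (closedForm (suc a) (suc b)) n ∎
  where
  open ≡-Reasoning
  double : ∀ c → c + c ≡ 2 * c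
  double c = cong (λ k → c + k) (sym (+-identityʳ c))
  dilate⊖ : ∀ c → (one ⊖ X^ (2 * c)) ≗ dilate (one ⊖ X^ c)
  dilate⊖ c i = sym (dilate-one⊖X^ c (2 * c) (double c) i)

-- The generating function of ℓ-regular partitions

regularFactor : ℕ → ℕ → PS
regularFactor ℓ m with ℓ ∣? m
... | yes _ = one
... | no  _ = inv (one ⊖ X^ m)

numeratorFactor : ℕ → ℕ → PS
numeratorFactor ℓ m with ℓ ∣? m
... | yes _ = one ⊖ X^ m
... | no  _ = one

regularFactor-∣ : ∀ {ℓ m} → ℓ ∣ m → regularFactor ℓ m ≡ one
regularFactor-∣ {ℓ} {m} ℓ∣m with ℓ ∣? m
... | yes _  = refl
... | no ℓ∤m = contradiction ℓ∣m ℓ∤m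

regularFactor-∤ : ∀ {ℓ m} → ¬ ℓ ∣ m → regularFactor ℓ m ≡ inv (one ⊖ X^ m)
regularFactor-∤ {ℓ} {m} ℓ∤m with ℓ ∣? m
... | yes ℓ∣m = contradiction ℓ∣m ℓ∤m
... | no _    = refl

numeratorFactor-∣ : ∀ {ℓ m} → ℓ ∣ m → numeratorFactor ℓ m ≡ one ⊖ X^ m
numeratorFactor-∣ {ℓ} {m} ℓ∣m with ℓ ∣? m
... | yes _  = refl
... | no ℓ∤m = contradiction ℓ∣m ℓ∤m

numeratorFactor-∤ : ∀ {ℓ m} → ¬ ℓ ∣ m → numeratorFactor ℓ m ≡ one
numeratorFactor-∤ {ℓ} {m} ℓ∤m with ℓ ∣? m
... | yes ℓ∣m = contradiction ℓ∣m ℓ∤m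
... | no _    = refl

regularFactor-⊛ : ∀ ℓ m → (regularFactor ℓ (suc m) ⊛ (one ⊖ X^ (suc m))) ≗ numeratorFactor ℓ (suc m)
regularFactor-⊛ ℓ m with ℓ ∣? suc m
... | yes _ = ⊛-identityˡ (one ⊖ X^ (suc m))
... | no _  = ⊛-inverseˡ (one ⊖ X^ (suc m)) refl

-- ∏_{m ≤ b, ℓ ∤ m} (1 − q^m)⁻¹: ℓ-regular partitions with parts at most b.
regularGF : ℕ → ℕ → PS
regularGF ℓ b = Π (λ k → regularFactor ℓ (suc k)) b

regularGF-⊛-Π : ∀ ℓ b → (regularGF ℓ b ⊛ Π (pochFactor 1) b) ≗ Π (numeratorFactor ℓ ∘ suc) b
regularGF-⊛-Π ℓ b = begin
  regularGF ℓ b ⊛ Π (pochFactor 1) b                     ≈⟨ Π-⊛ (regularFactor ℓ ∘ suc) (pochFactor 1) b ⟨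
  Π (λ k → regularFactor ℓ (suc k) ⊛ pochFactor 1 k) b  ≈⟨ Π-cong b factor ⟩
  Π (numeratorFactor ℓ ∘ suc) b                          ∎
  where
  open ≗-Reasoning
  factor : ∀ k → (regularFactor ℓ (suc k) ⊛ pochFactor 1 k) ≗ numeratorFactor ℓ (suc k)
  factor k i = cong (λ e → (regularFactor ℓ (suc k) ⊛ (one ⊖ X^ e)) i) (*-identityˡ (suc k))
               ∙ regularFactor-⊛ ℓ k i

-- Among kℓ + 1, …, kℓ + ℓ only the last is a multiple of ℓ.
Π-numerator-block : ∀ ℓ → 1 ≤ ℓ → ∀ k →
  Π (λ i → numeratorFactor ℓ (suc (k * ℓ + i))) ℓ ≗ pochFactor ℓ k
Π-numerator-block (suc l) _ k = begin
  Π φ (suc l)                             ≈⟨ Π-snoc φ l ⟩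
  Π φ l ⊛ φ l                             ≈⟨ ⊛-cong front-trivial (cong-app (numeratorFactor-∣ multiple)) ⟩
  one ⊛ (one ⊖ X^ (suc (k * suc l + l)))  ≈⟨ ⊛-identityˡ _ ⟩
  one ⊖ X^ (suc (k * suc l + l))          ≈⟨ cong-app (cong (λ e → one ⊖ X^ e) (degree l k)) ⟩
  pochFactor (suc l) k                    ∎
  where
  open ≗-Reasoning
  ℓ = suc l
  φ = λ i → numeratorFactor ℓ (suc (k * ℓ + i))
  not-multiple : ∀ i → i < l → φ i ≗ one
  not-multiple i i<l = cong-app (numeratorFactor-∤ ℓ∤)
    where
    ℓ∤ : ¬ ℓ ∣ suc (k * ℓ + i)
    ℓ∤ ℓ∣ = <⇒≱ (s≤s i<l) (∣⇒≤ (∣m+n∣m⇒∣n (subst (ℓ ∣_) (sym (+-suc (k * ℓ) i)) ℓ∣) (n∣m*n k)))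
  front-trivial : Π φ l ≗ one
  front-trivial i = Π-trivial φ l i (λ j j<l m _ → not-multiple j j<l m) i ≤-refl
  multiple : ℓ ∣ suc (k * ℓ + l)
  multiple = divides (suc k) (cong suc (+-comm (k * ℓ) l))
  degree : ∀ l k → suc (k * suc l + l) ≡ suc l * suc k
  degree = ℕ-Solver.solve-∀

Π-numerator : ∀ ℓ → 1 ≤ ℓ → ∀ k → Π (numeratorFactor ℓ ∘ suc) (k * ℓ) ≗ Π (pochFactor ℓ) k
Π-numerator ℓ 1≤ℓ zero    = λ _ → refl
Π-numerator ℓ 1≤ℓ (suc k) = begin
  Π φ (ℓ + k * ℓ)                          ≈⟨ cong-app (cong (Π φ) (+-comm ℓ (k * ℓ))) ⟩
  Π φ (k * ℓ + ℓ)                          ≈⟨ Π-+ φ (k * ℓ) ℓ ⟩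
  Π φ (k * ℓ) ⊛ Π (λ i → φ (k * ℓ + i)) ℓ  ≈⟨ ⊛-cong (Π-numerator ℓ 1≤ℓ k) (Π-numerator-block ℓ 1≤ℓ k) ⟩
  Π (pochFactor ℓ) k ⊛ pochFactor ℓ k      ≈⟨ Π-snoc (pochFactor ℓ) k ⟨
  Π (pochFactor ℓ) (suc k)                 ∎
  where
  open ≗-Reasoning
  φ = numeratorFactor ℓ ∘ suc

regularGF-⊛-poch : ∀ ℓ → 1 ≤ ℓ → ∀ n → (regularGF ℓ (suc n * ℓ) ⊛ poch 1) ≗[ n ] poch ℓ
regularGF-⊛-poch ℓ@(suc _) 1≤ℓ n i i≤n = begin
  (regularGF ℓ M ⊛ poch 1) i
    ≡⟨ ⊛-cong-upTo {regularGF ℓ M} n (λ _ _ → refl) (poch-≗-Π 1 ≤-refl n M n<M) i i≤n ⟩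
  (regularGF ℓ M ⊛ Π (pochFactor 1) M) i     ≡⟨ regularGF-⊛-Π ℓ M i ⟩
  Π (numeratorFactor ℓ ∘ suc) M i            ≡⟨ Π-numerator ℓ 1≤ℓ (suc n) i ⟩
  Π (pochFactor ℓ) (suc n) i                 ≡⟨ poch-≗-Π ℓ 1≤ℓ n (suc n) ≤-refl i i≤n ⟨
  poch ℓ i                                   ∎
  where
  open ≡-Reasoning
  M = suc n * ℓ
  n<M : n < M
  n<M = m≤m*n (suc n) ℓ

regularGF-suc : ∀ ℓ b → regularGF ℓ (suc b) ≗ (regularGF ℓ b ⊛ regularFactor ℓ (suc b))
regularGF-suc ℓ b = Π-snoc (λ k → regularFactor ℓ (suc k)) b

regularGF-suc-∣ : ∀ {ℓ b} → ℓ ∣ suc b → regularGF ℓ (suc b) ≗ regularGF ℓ b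
regularGF-suc-∣ {ℓ} {b} ℓ∣ n =
  regularGF-suc ℓ b n
  ∙ cong (λ f → (regularGF ℓ b ⊛ f) n) (regularFactor-∣ ℓ∣)
  ∙ ⊛-identityʳ (regularGF ℓ b) n

regularGF-suc-∤ : ∀ {ℓ b} → ¬ ℓ ∣ suc b → ∀ n →
  regularGF ℓ (suc b) n ≡ regularGF ℓ b n ℤ.+ (X^ (suc b) ⊛ regularGF ℓ (suc b)) n
regularGF-suc-∤ {ℓ} {b} ℓ∤ n = move (begin
  R' n ℤ.- (X^ (suc b) ⊛ R') n                   ≡⟨ cong (ℤ._- (X^ (suc b) ⊛ R') n) (⊛-identityˡ R' n) ⟨
  (one ⊛ R') n ℤ.- (X^ (suc b) ⊛ R') n           ≡⟨ ⊛-distribʳ-⊖ one (X^ (suc b)) R' n ⟨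
  ((one ⊖ X^ (suc b)) ⊛ R') n                    ≡⟨ ⊛-comm (one ⊖ X^ (suc b)) R' n ⟩
  (R' ⊛ (one ⊖ X^ (suc b))) n                    ≡⟨ ⊛-congˡ (regularGF-suc ℓ b) (one ⊖ X^ (suc b)) n ⟩
  ((R ⊛ regularFactor ℓ (suc b)) ⊛ (one ⊖ X^ (suc b))) n
      ≡⟨ cong (λ f → ((R ⊛ f) ⊛ (one ⊖ X^ (suc b))) n) (regularFactor-∤ ℓ∤) ⟩
  ((R ⊘ (one ⊖ X^ (suc b))) ⊛ (one ⊖ X^ (suc b))) n
      ≡⟨ ⊘-cancel R (one ⊖ X^ (suc b)) refl n ⟩
  R n                                            ∎)
  where
  open ≡-Reasoning
  R  = regularGF ℓ b
  R' = regularGF ℓ (suc b)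
  move : ∀ {x y z} → x ℤ.- y ≡ z → x ≡ z ℤ.+ y
  move {x} {y} refl = restore x y
    where
    restore : ∀ x y → x ≡ x ℤ.- y ℤ.+ y
    restore = solve-∀

regularGF-suc-< : ∀ ℓ b n → n < suc b → regularGF ℓ (suc b) n ≡ regularGF ℓ b n
regularGF-suc-< ℓ b n n<b+1 with ℓ ∣? suc b
... | yes ℓ∣ = regularGF-suc-∣ ℓ∣ n
... | no ℓ∤  = regularGF-suc-∤ ℓ∤ n
  ∙ cong (λ z → regularGF ℓ b n ℤ.+ z) (X^-⊛-< (suc b) (regularGF ℓ (suc b)) n n<b+1)
  ∙ ℤ.+-identityʳ (regularGF ℓ b n)

regularGF-suc-≥ : ∀ {ℓ b n} → ¬ ℓ ∣ suc b → suc b ≤ n →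
  regularGF ℓ (suc b) n ≡ regularGF ℓ b n ℤ.+ regularGF ℓ (suc b) (n ∸ suc b)
regularGF-suc-≥ {ℓ} {b} {n} ℓ∤ b+1≤n =
  regularGF-suc-∤ ℓ∤ n
  ∙ cong (λ z → regularGF ℓ b n ℤ.+ z) (X^-⊛-≥ (suc b) (regularGF ℓ (suc b)) n b+1≤n)

regularGF-at-0 : ∀ ℓ b → regularGF ℓ b 0 ≡ + 1
regularGF-at-0 ℓ zero    = refl
regularGF-at-0 ℓ (suc b) = regularGF-suc-< ℓ b 0 (s≤s z≤n) ∙ regularGF-at-0 ℓ b

regularGF-stable : ∀ ℓ n j → regularGF ℓ (n + j) n ≡ regularGF ℓ n n
regularGF-stable ℓ n zero    = cong (λ b → regularGF ℓ b n) (+-identityʳ n)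
regularGF-stable ℓ n (suc j) =
  cong (λ b → regularGF ℓ b n) (+-suc n j)
  ∙ regularGF-suc-< ℓ (n + j) n (s≤s (m≤m+n n j))
  ∙ regularGF-stable ℓ n j

poch-quotient : ∀ ℓ → 1 ≤ ℓ → ∀ n → (poch ℓ ⊘ poch 1) n ≡ regularGF ℓ n n
poch-quotient ℓ@(suc _) 1≤ℓ n =
  sym (⊘-unique (poch 1) (regularGF ℓ M) n refl (regularGF-⊛-poch ℓ 1≤ℓ n))
  ∙ cong (λ b → regularGF ℓ b n) (sym (m+[n∸m]≡n n≤M))
  ∙ regularGF-stable ℓ n (M ∸ n)
  where
  M = suc n * ℓ
  n≤M : n ≤ M
  n≤M = ≤-trans (n≤1+n n) (m≤m*n (suc n) ℓ)

-- Counting in lists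

count : ∀ {A : Set} {P : Pred A 0ℓ} → Decidable P → List A → ℕ
count P? xs = length (filter P? xs)

module _ {A : Set} {P : Pred A 0ℓ} (P? : Decidable P) where

  count-++ : ∀ xs ys → count P? (xs ++ ys) ≡ count P? xs + count P? ys
  count-++ xs ys = cong length (filter-++ P? xs ys) ∙ length-++ (filter P? xs)

  count-concatMap : ∀ {B : Set} (f : B → List A) xs → count P? (concatMap f xs) ≡ sum (map (count P? ∘ f) xs)
  count-concatMap f []       = refl
  count-concatMap f (x ∷ xs) = count-++ (f x) (concatMap f xs) ∙ cong (λ k → count P? (f x) + k) (count-concatMap f xs)

  count-map : ∀ {B : Set} (f : B → A) xs → count P? (map f xs) ≡ count (P? ∘ f) xs
  count-map f []       = refl
  count-map f (x ∷ xs) with does (P? (f x))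
  ... | true  = cong suc (count-map f xs)
  ... | false = count-map f xs

  count-none : ∀ {xs} → All (∁ P) xs → count P? xs ≡ 0
  count-none ¬P = cong length (filter-none P? ¬P)

  module _ {Q : Pred A 0ℓ} (Q? : Decidable Q) where

    count-≐ : P ≐ Q → ∀ xs → count P? xs ≡ count Q? xs
    count-≐ P≐Q xs = cong length (filter-≐ P? Q? P≐Q xs)

    count-∪ : (∀ {x} → P x → Q x → ⊥) → ∀ xs → count (P? ∪? Q?) xs ≡ count P? xs + count Q? xs
    count-∪ disjoint []       = refl
    count-∪ disjoint (x ∷ xs) with P? x | Q? x
    ... | yes p | yes q = contradiction q (disjoint p)
    ... | yes _ | no _  = cong suc (count-∪ disjoint xs)
    ... | no _  | yes _ = cong suc (count-∪ disjoint xs) ∙ sym (+-suc (count P? xs) (count Q? xs))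
    ... | no _  | no _  = count-∪ disjoint xs

-- candidates n is definitionally listsUpTo (map suc (upTo n)) (suc n).
listsUpTo : List ℕ → ℕ → List (List ℕ)
listsUpTo V n = concatMap (λ k → listsOfLength k V) (upTo n)

listsOfLength-length : ∀ V k → All (λ t → length t ≡ k) (listsOfLength k V)
listsOfLength-length V zero    = refl ∷ []
listsOfLength-length V (suc k) =
  concat⁺ (map⁺ (All.universal (λ x → map⁺ (All.map (cong suc) (listsOfLength-length V k))) V))

count-listsUpTo-+ : ∀ {Q : Pred (List ℕ) 0ℓ} (Q? : Decidable Q) V {m} → (∀ {t} → Q t → length t < m) →
  ∀ j → count Q? (listsUpTo V (m + j)) ≡ count Q? (listsUpTo V m)
count-listsUpTo-+ Q? V {m} short zero = cong (count Q? ∘ listsUpTo V) (+-identityʳ m)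
count-listsUpTo-+ {Q} Q? V {m} short (suc j) = begin
  count Q? (listsUpTo V (m + suc j))
    ≡⟨ cong (count Q? ∘ listsUpTo V) (+-suc m j) ⟩
  count Q? (concatMap S (upTo (suc (m + j))))
    ≡⟨ cong (count Q? ∘ concatMap S) (upTo-∷ʳ (m + j)) ⟨
  count Q? (concatMap S (upTo (m + j) ∷ʳ (m + j)))
    ≡⟨ cong (count Q?) (concatMap-++ S (upTo (m + j)) [ m + j ]) ⟩
  count Q? (listsUpTo V (m + j) ++ (S (m + j) ++ []))
    ≡⟨ count-++ Q? (listsUpTo V (m + j)) (S (m + j) ++ []) ⟩
  count Q? (listsUpTo V (m + j)) + count Q? (S (m + j) ++ [])
    ≡⟨ cong (λ k → count Q? (listsUpTo V (m + j)) + k)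
            (count-none Q? (++⁺ (All.map too-long (listsOfLength-length V (m + j))) [])) ⟩
  count Q? (listsUpTo V (m + j)) + 0
    ≡⟨ +-identityʳ _ ⟩
  count Q? (listsUpTo V (m + j))
    ≡⟨ count-listsUpTo-+ Q? V short j ⟩
  count Q? (listsUpTo V m) ∎
  where
  open ≡-Reasoning
  S = λ k → listsOfLength k V
  too-long : ∀ {t} → length t ≡ m + j → ¬ Q t
  too-long {t} len≡ q = <⇒≱ (short q) (subst (m ≤_) (sym len≡) (m≤m+n m j))

count-listsUpTo-≥ : ∀ {Q : Pred (List ℕ) 0ℓ} (Q? : Decidable Q) V {m} → (∀ {t} → Q t → length t < m) →
  ∀ {n} → m ≤ n → count Q? (listsUpTo V n) ≡ count Q? (listsUpTo V m)
count-listsUpTo-≥ Q? V {m} short {n} m≤n =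
  cong (count Q? ∘ listsUpTo V) (sym (m+[n∸m]≡n m≤n)) ∙ count-listsUpTo-+ Q? V short (n ∸ m)

StartsWith : ℕ → Pred (List ℕ) 0ℓ → Pred (List ℕ) 0ℓ
StartsWith c Q []      = ⊥
StartsWith c Q (x ∷ t) = x ≡ c × Q t

startsWith? : ∀ {Q} c → Decidable Q → Decidable (StartsWith c Q)
startsWith? c Q? []      = no λ ()
startsWith? c Q? (x ∷ t) = x ≟ c ×-dec Q? t

count-startsWith : ∀ {Q} c (Q? : Decidable Q) L W →
  count (startsWith? c Q?) (concatMap (λ x → map (x ∷_) L) W) ≡ count (_≟ c) W * count Q? L
count-startsWith c Q? L []       = refl
count-startsWith c Q? L (x ∷ W) =
  count-++ (startsWith? c Q?) (map (x ∷_) L) (concatMap (λ x → map (x ∷_) L) W)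
  ∙ cong₂ _+_ (count-map (startsWith? c Q?) (x ∷_) L) (count-startsWith c Q? L W)
  ∙ head-term
  where
  head-term : count (λ t → x ≟ c ×-dec Q? t) L + count (_≟ c) W * count Q? L ≡ count (_≟ c) (x ∷ W) * count Q? L
  head-term with x ≟ c
  ... | yes refl = cong (_+ count (_≟ c) W * count Q? L) (count-≐ _ Q? ((λ (_ , q) → q) , (λ q → refl , q)) L)
                   ∙ cong (λ xs → length xs * count Q? L) (sym (filter-accept (_≟ c) refl))
  ... | no x≢c   = cong (_+ count (_≟ c) W * count Q? L) (count-none _ (All.universal (λ t (x≡c , _) → x≢c x≡c) L))
                   ∙ cong (λ xs → length xs * count Q? L) (sym (filter-reject (_≟ c) x≢c))

count-≟-suc : ∀ c xs → count (_≟ suc c) (map suc xs) ≡ count (_≟ c) xs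
count-≟-suc c xs = count-map (_≟ suc c) suc xs ∙ count-≐ _ (_≟ c) (suc-injective , cong suc) xs

count-≟-upTo : ∀ {c n} → c < n → count (_≟ c) (upTo n) ≡ 1
count-≟-upTo {zero}  {suc n} _ =
  cong (λ xs → suc (count (_≟ 0) xs)) (sym (map-applyUpTo id suc n))
  ∙ cong suc (count-map (_≟ 0) suc (upTo n) ∙ count-none _ (All.universal (λ _ ()) (upTo n)))
count-≟-upTo {suc c} {suc n} (s≤s c<n) =
  cong (count (_≟ suc c)) (sym (map-applyUpTo id suc n)) ∙ count-≟-suc c (upTo n) ∙ count-≟-upTo c<n

count-startsWith-listsUpTo : ∀ {Q} c (Q? : Decidable Q) V n → count (_≟ c) V ≡ 1 →
  count (startsWith? c Q?) (listsUpTo V (suc n)) ≡ count Q? (listsUpTo V n)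
count-startsWith-listsUpTo c Q? V n unique = begin
  count (startsWith? c Q?) (concat (map S (applyUpTo suc n)))
    ≡⟨ cong (count (startsWith? c Q?) ∘ concat) (map-applyUpTo suc S n ∙ sym (map-applyUpTo id (S ∘ suc) n)) ⟩
  count (startsWith? c Q?) (concatMap (S ∘ suc) (upTo n))
    ≡⟨ count-concatMap (startsWith? c Q?) (S ∘ suc) (upTo n) ⟩
  sum (map (count (startsWith? c Q?) ∘ S ∘ suc) (upTo n))
    ≡⟨ cong sum (map-cong tail-count (upTo n)) ⟩
  sum (map (count Q? ∘ S) (upTo n))
    ≡⟨ count-concatMap Q? S (upTo n) ⟨
  count Q? (listsUpTo V n) ∎
  where
  open ≡-Reasoning
  S = λ k → listsOfLength k V
  tail-count : ∀ k → count (startsWith? c Q?) (S (suc k)) ≡ count Q? (S k)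
  tail-count k = count-startsWith c Q? (S k) V ∙ cong (_* count Q? (S k)) unique ∙ +-identityʳ _

-- Counting ℓ-regular partitions

RegularPartition : ℕ → ℕ → ℕ → Pred (List ℕ) 0ℓ
RegularPartition ℓ b s t = IsPartition s t × All (_≤ b) t × IsRegular ℓ t

regularPartition? : ∀ ℓ b s → Decidable (RegularPartition ℓ b s)
regularPartition? ℓ b s t = isPartition? s t ×-dec (all? (_≤? b) t ×-dec all? (λ p → ¬? (ℓ ∣? p)) t)

regularCount : ℕ → ℕ → ℕ → ℕ → ℕ
regularCount ℓ n b s = count (regularPartition? ℓ b s) (candidates n)

length≤sum : ∀ {t} → All (1 ≤_) t → length t ≤ sum t
length≤sum []          = z≤n
length≤sum (1≤p ∷ pos) = +-mono-≤ 1≤p (length≤sum pos)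

parts≤sum : ∀ t → All (_≤ sum t) t
parts≤sum []      = []
parts≤sum (p ∷ t) = m≤m+n p (sum t) ∷ All.map (λ q≤ → ≤-trans q≤ (m≤n+m (sum t) p)) (parts≤sum t)

regularPartition-short : ∀ {ℓ b s t} → RegularPartition ℓ b s t → length t < suc s
regularPartition-short {t = t} ((_ , pos , sum≡s) , _) = s≤s (subst (length t ≤_) sum≡s (length≤sum pos))

linked-∷ : ∀ {x t} → All (_≤ x) t → Linked _≥_ t → Linked _≥_ (x ∷ t)
linked-∷ []          _ = [-]
linked-∷ (y≤x ∷ _) L = y≤x ∷ L

linked-head-max : ∀ {x t} → Linked _≥_ (x ∷ t) → All (_≤ x) t
linked-head-max L = All.tail (Linked⇒All (λ j≤i k≤j → ≤-trans k≤j j≤i) ≤-refl L)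

regularPartition-skip : ∀ {ℓ b s} → ℓ ∣ suc b ⊎ s < suc b →
  RegularPartition ℓ (suc b) s ≐ RegularPartition ℓ b s
regularPartition-skip {ℓ} {b} {s} b+1-absent =
  (λ { {t} (P@(_ , _ , sum≡s) , bound , reg) →
         P , All.zipWith (λ (p≤b+1 , ℓ∤p , p≤s) → s≤s⁻¹ (≤∧≢⇒< p≤b+1 (absent b+1-absent ℓ∤p p≤s)))
                         (bound , All.zip (reg , subst (λ m → All (_≤ m) t) sum≡s (parts≤sum t))) , reg })
  , (λ (P , bound , reg) → P , All.map m≤n⇒m≤1+n bound , reg)
  where
  absent : ∀ {p} → ℓ ∣ suc b ⊎ s < suc b → ¬ ℓ ∣ p → p ≤ s → p ≢ suc b
  absent (inj₁ ℓ∣b+1) ℓ∤p _   refl = ℓ∤p ℓ∣b+1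
  absent (inj₂ s<b+1) _   p≤s refl = <⇒≱ s<b+1 p≤s

regularPartition-split : ∀ {ℓ b s} → ¬ ℓ ∣ suc b → suc b ≤ s →
  RegularPartition ℓ (suc b) s
    ≐ RegularPartition ℓ b s ∪ StartsWith (suc b) (RegularPartition ℓ (suc b) (s ∸ suc b))
regularPartition-split {ℓ} {b} {s} ℓ∤b+1 b+1≤s = split , join
  where
  split : RegularPartition ℓ (suc b) s
            ⊆ RegularPartition ℓ b s ∪ StartsWith (suc b) (RegularPartition ℓ (suc b) (s ∸ suc b))
  split {[]}    (P , [] , []) = inj₁ (P , [] , [])
  split {x ∷ t} (P@(L , pos , sum≡s) , x≤b+1 ∷ bound , reg) with m≤n⇒m<n∨m≡n x≤b+1
  ... | inj₁ x<b+1 =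
    inj₁ (P , s≤s⁻¹ x<b+1 ∷ All.map (λ y≤x → ≤-trans y≤x (s≤s⁻¹ x<b+1)) (linked-head-max L) , reg)
  ... | inj₂ refl  = inj₂ (refl , (Linked.tail L , All.tail pos , tail-sum) , linked-head-max L , All.tail reg)
    where
    tail-sum : sum t ≡ s ∸ suc b
    tail-sum = sym (m+n∸m≡n (suc b) (sum t)) ∙ cong (_∸ suc b) sum≡s
  join : RegularPartition ℓ b s ∪ StartsWith (suc b) (RegularPartition ℓ (suc b) (s ∸ suc b))
           ⊆ RegularPartition ℓ (suc b) s
  join (inj₁ (P , bound , reg)) = P , All.map m≤n⇒m≤1+n bound , reg
  join {x ∷ t} (inj₂ (refl , (L , pos , sum≡) , bound , reg)) =
    (linked-∷ bound L , s≤s z≤n ∷ pos , cong (λ k → suc b + k) sum≡ ∙ m+[n∸m]≡n b+1≤s)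
    , ≤-refl ∷ bound , ℓ∤b+1 ∷ reg

regularPartition-disjoint : ∀ {ℓ b s s' t} →
  RegularPartition ℓ b s t → StartsWith (suc b) (RegularPartition ℓ (suc b) s') t → ⊥
regularPartition-disjoint {t = x ∷ t} (_ , x≤b ∷ _ , _) (refl , _) = 1+n≰n x≤b

regularCount-zero : ∀ ℓ n s → + regularCount ℓ n 0 s ≡ regularGF ℓ 0 s
regularCount-zero ℓ n s =
  cong +_ (count-listsUpTo-≥ (regularPartition? ℓ 0 s) (map suc (upTo n)) only-empty {suc n} (s≤s z≤n))
  ∙ empty-partition s
  where
  only-empty : ∀ {t} → RegularPartition ℓ 0 s t → length t < 1
  only-empty {[]}    _                               = s≤s z≤n
  only-empty {x ∷ t} ((_ , 1≤x ∷ _ , _) , x≤0 ∷ _ , _) = contradiction (≤-trans 1≤x x≤0) λ ()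
  empty-partition : ∀ s → + count (regularPartition? ℓ 0 s) ([] ∷ []) ≡ one s
  empty-partition zero    = refl
  empty-partition (suc s) = refl

regularCount-skip : ∀ {ℓ n b s} → ℓ ∣ suc b ⊎ s < suc b → regularCount ℓ n (suc b) s ≡ regularCount ℓ n b s
regularCount-skip {ℓ} {n} {b} {s} b+1-absent =
  count-≐ (regularPartition? ℓ (suc b) s) (regularPartition? ℓ b s) (regularPartition-skip b+1-absent) (candidates n)

regularCount-split : ∀ {ℓ n b s} → ¬ ℓ ∣ suc b → suc b ≤ s → s ≤ n →
  regularCount ℓ n (suc b) s ≡ regularCount ℓ n b s + regularCount ℓ n (suc b) (s ∸ suc b)
regularCount-split {ℓ} {n} {b} {s} ℓ∤b+1 b+1≤s s≤n = begin
  count (regularPartition? ℓ (suc b) s) (listsUpTo V (suc n))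
    ≡⟨ count-≐ (regularPartition? ℓ (suc b) s) (regularPartition? ℓ b s ∪? startsWith? (suc b) Rest?)
                (regularPartition-split ℓ∤b+1 b+1≤s) (listsUpTo V (suc n)) ⟩
  count (regularPartition? ℓ b s ∪? startsWith? (suc b) Rest?) (listsUpTo V (suc n))
    ≡⟨ count-∪ (regularPartition? ℓ b s) (startsWith? (suc b) Rest?) regularPartition-disjoint (listsUpTo V (suc n)) ⟩
  regularCount ℓ n b s + count (startsWith? (suc b) Rest?) (listsUpTo V (suc n))
    ≡⟨ cong (λ k → regularCount ℓ n b s + k) (count-startsWith-listsUpTo (suc b) Rest? V n unique) ⟩
  regularCount ℓ n b s + count Rest? (listsUpTo V n)
    ≡⟨ cong (λ k → regularCount ℓ n b s + k) (count-listsUpTo-≥ Rest? V regularPartition-short rest<n) ⟩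
  regularCount ℓ n b s + count Rest? (listsUpTo V (suc (s ∸ suc b)))
    ≡⟨ cong (λ k → regularCount ℓ n b s + k)
            (count-listsUpTo-≥ Rest? V regularPartition-short (m≤n⇒m≤1+n rest<n)) ⟨
  regularCount ℓ n b s + regularCount ℓ n (suc b) (s ∸ suc b) ∎
  where
  open ≡-Reasoning
  V = map suc (upTo n)
  Rest? = regularPartition? ℓ (suc b) (s ∸ suc b)
  unique : count (_≟ suc b) V ≡ 1
  unique = count-≟-suc b (upTo n) ∙ count-≟-upTo (≤-trans b+1≤s s≤n)
  rest<n : suc (s ∸ suc b) ≤ n
  rest<n = ≤-trans (∸-monoʳ-< z<s b+1≤s) s≤n

regularCount-regularGF : ∀ ℓ n b s → s ≤ n → + regularCount ℓ n b s ≡ regularGF ℓ b s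
regularCount-regularGF ℓ n zero    s _ = regularCount-zero ℓ n s
regularCount-regularGF ℓ n (suc b) = <-rec _ step
  where
  step : ∀ s → (∀ {s'} → s' < s → s' ≤ n → + regularCount ℓ n (suc b) s' ≡ regularGF ℓ (suc b) s') →
         s ≤ n → + regularCount ℓ n (suc b) s ≡ regularGF ℓ (suc b) s
  step s rec s≤n with ℓ ∣? suc b | suc b ≤? s
  ... | yes ℓ∣ | _ =
    cong +_ (regularCount-skip {ℓ} {n} {b} {s} (inj₁ ℓ∣)) ∙ regularCount-regularGF ℓ n b s s≤n
    ∙ sym (regularGF-suc-∣ ℓ∣ s)
  ... | no ℓ∤ | no b+1≰s =
    cong +_ (regularCount-skip {ℓ} {n} {b} {s} (inj₂ (≰⇒> b+1≰s))) ∙ regularCount-regularGF ℓ n b s s≤n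
    ∙ sym (regularGF-suc-< ℓ b s (≰⇒> b+1≰s))
  ... | no ℓ∤ | yes b+1≤s =
    cong +_ (regularCount-split {ℓ} {n} ℓ∤ b+1≤s s≤n)
    ∙ ℤ.pos-+ (regularCount ℓ n b s) (regularCount ℓ n (suc b) (s ∸ suc b))
    ∙ cong₂ ℤ._+_ (regularCount-regularGF ℓ n b s s≤n)
                  (rec (∸-monoʳ-< z<s b+1≤s) (≤-trans (m∸n≤m s (suc b)) s≤n))
    ∙ sym (regularGF-suc-≥ ℓ∤ b+1≤s)

-- The partitions counted by ρ_ℓ

ρ-vanishes : ∀ ℓ N → (∀ x → 1 ≤ x → x + x ≢ N) → ρ ℓ N ≡ 0
ρ-vanishes ℓ N no-half =
  count-none (λ xs → isPartition? N xs ×-dec rhoShape? ℓ xs) (All.universal not-ρ-shaped (candidates N))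
  where
  not-ρ-shaped : ∀ xs → ¬ (IsPartition N xs × RhoShape ℓ xs)
  not-ρ-shaped []      (_ , ())
  not-ρ-shaped (x ∷ t) ((_ , 1≤x ∷ _ , sum≡N) , _ , (_ , _ , sum≡x) , _) =
    no-half x 1≤x (cong (λ k → x + k) (sym sum≡x) ∙ sum≡N)

ρ-even : ∀ ℓ μ → ρ ℓ (suc μ + suc μ) ≡ regularCount ℓ (suc μ + suc μ) μ (suc μ)
ρ-even ℓ μ =
  count-≐ (λ xs → isPartition? N xs ×-dec rhoShape? ℓ xs) (startsWith? (suc μ) Part?) (split , join) (candidates N)
  ∙ count-startsWith-listsUpTo (suc μ) Part? V N unique
  ∙ count-listsUpTo-≥ Part? V regularPartition-short half<N
  ∙ sym (count-listsUpTo-≥ Part? V regularPartition-short (m≤n⇒m≤1+n half<N))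
  where
  N = suc μ + suc μ
  V = map suc (upTo N)
  Part? = regularPartition? ℓ μ (suc μ)
  half<N : suc (suc μ) ≤ N
  half<N = s≤s (subst (suc μ ≤_) (sym (+-suc μ μ)) (s≤s (m≤m+n μ μ)))
  unique : count (_≟ suc μ) V ≡ 1
  unique = count-≟-suc μ (upTo N) ∙ count-≟-upTo (≤-trans (n≤1+n (suc μ)) half<N)
  split : ∀ {xs} → IsPartition N xs × RhoShape ℓ xs → StartsWith (suc μ) (RegularPartition ℓ μ (suc μ)) xs
  split {x ∷ t} ((_ , _ , sum≡N) , below , P@(_ , _ , sum≡x) , reg)
    with m+m≡n+n⇒m≡n {x} {suc μ} (cong (λ k → x + k) (sym sum≡x) ∙ sum≡N)
  ... | refl = refl , P , All.map s≤s⁻¹ below , reg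
  join : ∀ {xs} → StartsWith (suc μ) (RegularPartition ℓ μ (suc μ)) xs → IsPartition N xs × RhoShape ℓ xs
  join {x ∷ t} (refl , P@(L , pos , sum≡) , bound , reg) =
    (linked-∷ (All.map m≤n⇒m≤1+n bound) L , s≤s z≤n ∷ pos , cong (λ k → suc μ + k) sum≡)
    , All.map s≤s bound , P , reg

-- ρ-half ℓ λ = ρ_ℓ(2λ): the number of ℓ-regular partitions of λ into parts smaller than λ.
ρ-half : ℕ → PS
ρ-half ℓ zero    = + 0
ρ-half ℓ (suc μ) = regularGF ℓ μ (suc μ)

ρ-dilate : ∀ ℓ n → + ρ ℓ n ≡ dilate (ρ-half ℓ) n
ρ-dilate ℓ n with parity n
... | even zero    = cong +_ (ρ-vanishes ℓ 0 λ { (suc x) _ () })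
... | even (suc μ) =
  cong +_ (ρ-even ℓ μ) ∙ regularCount-regularGF ℓ _ μ (suc μ) (m≤m+n (suc μ) (suc μ))
  ∙ sym (dilate-even (ρ-half ℓ) (suc μ))
... | odd m        = cong +_ (ρ-vanishes ℓ _ (λ x _ → m+m≢1+n+n x m)) ∙ sym (dilate-odd (ρ-half ℓ) m)

closedForm-coeff : ∀ ℓ → 1 ≤ ℓ → ∀ n →
  closedForm 1 ℓ n ≡ regularGF ℓ n n ℤ.- + 1 ℤ.+ (geometric ℓ n ℤ.- one n)
closedForm-coeff ℓ 1≤ℓ n =
  cong₂ ℤ._+_ (cong₂ ℤ._-_ (poch-quotient ℓ 1≤ℓ n) (one⊘geometric 1 ≤-refl n ∙ geometric-∣ (1∣ n)))
              (X^⊘geometric ℓ 1≤ℓ n)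

ρ-half-closedForm : ∀ ℓ → 1 ≤ ℓ → ρ-half ℓ ≗ closedForm 1 ℓ
ρ-half-closedForm ℓ 1≤ℓ zero =
  sym (closedForm-coeff ℓ 1≤ℓ 0 ∙ cong (λ g → + 1 ℤ.- + 1 ℤ.+ (g ℤ.- + 1)) (geometric-∣ (ℓ ∣0)))
ρ-half-closedForm ℓ 1≤ℓ (suc μ) with ℓ ∣? suc μ
... | yes ℓ∣ = sym (closedForm-coeff ℓ 1≤ℓ (suc μ)
  ∙ cong₂ (λ r g → r ℤ.- + 1 ℤ.+ (g ℤ.- + 0)) (regularGF-suc-∣ ℓ∣ (suc μ)) (geometric-∣ ℓ∣)
  ∙ cancel (regularGF ℓ μ (suc μ)))
  where
  cancel : ∀ g → g ℤ.- + 1 ℤ.+ (+ 1 ℤ.- + 0) ≡ g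
  cancel = solve-∀
... | no ℓ∤ = sym (closedForm-coeff ℓ 1≤ℓ (suc μ)
  ∙ cong₂ (λ r g → r ℤ.- + 1 ℤ.+ (g ℤ.- + 0)) one-part (geometric-∤ ℓ∤)
  ∙ cancel (regularGF ℓ μ (suc μ)))
  where
  one-part : regularGF ℓ (suc μ) (suc μ) ≡ regularGF ℓ μ (suc μ) ℤ.+ + 1
  one-part = regularGF-suc-≥ ℓ∤ ≤-refl
    ∙ cong (λ m → regularGF ℓ μ (suc μ) ℤ.+ regularGF ℓ (suc μ) m) (n∸n≡0 μ)
    ∙ cong (λ r → regularGF ℓ μ (suc μ) ℤ.+ r) (regularGF-at-0 ℓ (suc μ))
  cancel : ∀ g → g ℤ.+ + 1 ℤ.- + 1 ℤ.+ (+ 0 ℤ.- + 0) ≡ g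
  cancel = solve-∀

theorem1p1 : (ℓ : ℕ) → 1 ≤ ℓ → (n : ℕ) →
    + ρ ℓ n ≡ (poch (2 * ℓ) ⊘ poch 2 ⊖ one ⊘ (one ⊖ X^ 2) ⊕ X^ (2 * ℓ) ⊘ (one ⊖ X^ (2 * ℓ))) n
theorem1p1 ℓ 1≤ℓ n = begin
  + ρ ℓ n                      ≡⟨ ρ-dilate ℓ n ⟩
  dilate (ρ-half ℓ) n          ≡⟨ dilate-cong (ρ-half-closedForm ℓ 1≤ℓ) n ⟩
  dilate (closedForm 1 ℓ) n    ≡⟨ closedForm-dilate 1 ℓ ≤-refl 1≤ℓ n ⟨
  closedForm 2 (2 * ℓ) n       ∎
  where open ≡-Reasoning
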